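{- Let $\sigma$ be a permutation of size $n$, let $1\le k\le n-1$, and let $\lambda\in X(k,n-k)$ with $\lambda\ne \mathsf{S}^k\mathsf{L}^{n-k}$. Let $\lambda'$ be the word obtained from $\lambda$ by replacing every occurrence of the factor $\mathsf{L}\mathsf{S}$ by $\mathsf{S}\mathsf{L}$ (simultaneously). If $\mathrm{shadow}_k(\sigma)\preccurlyeq\lambda$, then $\mathrm{shadow}_k(T(\sigma))\preccurlyeq\lambda'$.
   Context: Falls of a permutation are its maximal decreasing strings of consecutive entries; the flip $T$ reverses every fall in place. For $1\le k\le n-1$, $X(k,n-k)$ is the set of words of length $n$ over $\{\mathsf{S},\mathsf{L}\}$ with exactly $k$ letters $\mathsf{S}$ and $n-k$ letters $\mathsf{L}$. For $\lambda,\mu\in X(k,n-k)$, $\lambda\preccurlyeq\mu$ means that for each $j$, $1\le j\le k$, the position of the $j$th $\mathsf{S}$ (counted from the left) in $\lambda$ is less than or equal to the position of the $j$th $\mathsf{S}$ in $\mu$. For a permutation $\sigma$ of size $n$, $\mathrm{shadow}_k(\sigma)\in X(k,n-k)$ is obtained from the one-line notation of $\sigma$ by replacing each entry in $\{1,\dots,k\}$ by $\mathsf{S}$ and each entry in $\{k+1,\dots,n\}$ by $\mathsf{L}$. -}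

module Defs where

open import Data.Nat using (ℕ; zero; suc; _≤_; _<ᵇ_; _≤ᵇ_; _∸_)
open import Data.Bool using (Bool; true; false; if_then_else_)
open import Data.List using (List; []; _∷_; _++_; length; reverse; concat; map; applyUpTo; replicate)
open import Data.List.Relation.Binary.Pointwise using (Pointwise)
open import Data.List.Relation.Binary.Permutation.Propositional using (_↭_)
open import Relation.Binary.PropositionalEquality using (_≡_)
open import Data.Product using (_×_)

IsPerm : ℕ → List ℕ → Set
IsPerm n σ = σ ↭ applyUpTo suc n

-- Falls: maximal decreasing strings of consecutive entries (a partition of the list into blocks).
falls : List ℕ → List (List ℕ)
falls [] = []
falls (x ∷ xs) with falls xs
... | [] = (x ∷ []) ∷ []
... | [] ∷ rs = (x ∷ []) ∷ rs   -- unreachable: blocks are nonempty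
... | (y ∷ r) ∷ rs = if y <ᵇ x then (x ∷ y ∷ r) ∷ rs else (x ∷ []) ∷ (y ∷ r) ∷ rs

T : List ℕ → List ℕ
T σ = concat (map reverse (falls σ))

data Letter : Set where
  S L : Letter

countS : List Letter → ℕ
countS [] = 0
countS (S ∷ w) = suc (countS w)
countS (L ∷ w) = countS w

InX : ℕ → ℕ → List Letter → Set
InX k n w = (length w ≡ n) × (countS w ≡ k)

sPosFrom : ℕ → List Letter → List ℕ
sPosFrom i [] = []
sPosFrom i (S ∷ w) = i ∷ sPosFrom (suc i) w
sPosFrom i (L ∷ w) = sPosFrom (suc i) w

sPositions : List Letter → List ℕ
sPositions = sPosFrom 1

_≼_ : List Letter → List Letter → Set
λ₁ ≼ μ = Pointwise _≤_ (sPositions λ₁) (sPositions μ)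

shadow : ℕ → List ℕ → List Letter
shadow k σ = map (λ x → if x ≤ᵇ k then S else L) σ

-- Replace every occurrence of the factor LS by SL simultaneously
-- (occurrences of LS never overlap, so a left-to-right scan is exact).
swapLS : List Letter → List Letter
swapLS [] = []
swapLS (L ∷ S ∷ w) = S ∷ L ∷ swapLS w
swapLS (x ∷ w) = x ∷ swapLS w

minWord : ℕ → ℕ → List Letter
minWord k n = replicate k S ++ replicate (n ∸ k) L

module Submission where

-- Proof strategy.
--
--  (A) shadow k (T σ) ≼ swapLS (shadow k σ).  A fall is decreasing, so its shadow
--      is a block L^a S^b; reversing it gives S^b L^a, the least word with these
--      letter counts, while swapLS preserves letter counts.  Moreover no factor LS
--      straddles two consecutive falls (a large entry cannot be followed by a
--      smaller small one at a fall boundary), so swapLS acts blockwise.  These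
--      comparisons are made with the relation 'Ahead' (prefix-count domination),
--      which is closed under concatenation and composition and implies ≼.
--  (B) swapLS is monotone for ≼: on S-positions it subtracts 1 from every position
--      not immediately following the previous S, and this map is monotone.

open import Defs
open import Data.Nat using (ℕ; _≤_; _∸_)
open import Data.List using (List)
open import Relation.Binary.PropositionalEquality using (_≢_)

open import Data.Nat using (zero; suc; _+_; _<_; _<ᵇ_; _≤ᵇ_; pred; z≤n; s≤s)
open import Data.Nat.Properties
open import Data.Bool using (true; false; if_then_else_) renaming (T to IsTrue)
open import Data.List using ([]; _∷_; [_]; _++_; concat; map; reverse; replicate; length)
open import Data.List.Properties
  using (++-assoc; ++-identityʳ; length-++; concat-map; reverse-map; map-∘; map-cong; unfold-reverse)
open import Data.List.Relation.Unary.All as All using (All; []; _∷_)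
open import Data.List.Relation.Unary.All.Properties using (++⁺)
open import Data.List.Relation.Binary.Pointwise using (Pointwise; []; _∷_)
open import Data.List.Relation.Binary.Pointwise.Properties using (transitive)
open import Relation.Binary.PropositionalEquality
  using (_≡_; refl; sym; trans; cong; cong₂; subst; subst₂; module ≡-Reasoning)
open import Relation.Nullary using (yes; no; contradiction)
open import Data.Unit using (⊤; tt)
open import Data.Product using (_×_; _,_)
open import Function using (_∘_)

-- Ahead d e u v: reading u and v (of equal length) in parallel, the surplus
-- "number of S read in u minus number of S read in v", starting from d, never
-- becomes negative and ends at e.  Ahead 0 0 u v is domination of u over v.
data Ahead : ℕ → ℕ → List Letter → List Letter → Set where
  nil : ∀ {d} → Ahead d d [] []
  SS  : ∀ {d e u v} → Ahead d e u v → Ahead d e (S ∷ u) (S ∷ v)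
  LL  : ∀ {d e u v} → Ahead d e u v → Ahead d e (L ∷ u) (L ∷ v)
  SL  : ∀ {d e u v} → Ahead (suc d) e u v → Ahead d e (S ∷ u) (L ∷ v)
  LS  : ∀ {d e u v} → Ahead d e u v → Ahead (suc d) e (L ∷ u) (S ∷ v)

ahead-refl : ∀ {d} u → Ahead d d u u
ahead-refl []      = nil
ahead-refl (S ∷ u) = SS (ahead-refl u)
ahead-refl (L ∷ u) = LL (ahead-refl u)

ahead-++ : ∀ {d e f u₁ v₁ u₂ v₂} →
  Ahead d e u₁ v₁ → Ahead e f u₂ v₂ → Ahead d f (u₁ ++ u₂) (v₁ ++ v₂)
ahead-++ nil    q = q
ahead-++ (SS p) q = SS (ahead-++ p q)
ahead-++ (LL p) q = LL (ahead-++ p q)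
ahead-++ (SL p) q = SL (ahead-++ p q)
ahead-++ (LS p) q = LS (ahead-++ p q)

recast : ∀ {d d′ e u v} → d ≡ d′ → Ahead d e u v → Ahead d′ e u v
recast refl a = a

ahead-trans : ∀ {d₁ e₁ d₂ e₂ u v w} →
  Ahead d₁ e₁ u v → Ahead d₂ e₂ v w → Ahead (d₁ + d₂) (e₁ + e₂) u w
ahead-trans nil    nil    = nil
ahead-trans (SS p) (SS q) = SS (ahead-trans p q)
ahead-trans (LL p) (LL q) = LL (ahead-trans p q)
ahead-trans (SL p) (LL q) = SL (ahead-trans p q)
ahead-trans (LS p) (SS q) = LS (ahead-trans p q)
ahead-trans {d₁} {d₂ = d₂} (SS p) (SL q) =
  SL (recast (+-suc d₁ d₂) (ahead-trans p q))
ahead-trans {d₁} (LL p) (LS {d = d₂} q) =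
  recast (sym (+-suc d₁ d₂)) (LS (ahead-trans p q))
ahead-trans {d₁} (SL p) (LS {d = d₂} q) =
  SS (recast (sym (+-suc d₁ d₂)) (ahead-trans p q))
ahead-trans {suc d₁} {d₂ = d₂} (LS p) (SL q) =
  LL (recast (+-suc d₁ d₂) (ahead-trans p q))

-- Soundness for ≼, with an invariant: 'pending' lists (oldest first) the
-- positions of the S's of u already read and not yet matched by an S of v;
-- there are exactly d of them, all at most the current position i.
ahead⇒pointwise : ∀ {d u v} i pending → Ahead d 0 u v →
  length pending ≡ d → All (_≤ i) pending →
  Pointwise _≤_ (pending ++ sPosFrom i u) (sPosFrom i v)

-- The S just read at position i is matched later: it joins the end of the queue.
enqueue : ∀ {u v} i ps → Ahead (suc (length ps)) 0 u v → All (_≤ i) ps →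
  Pointwise _≤_ (ps ++ i ∷ sPosFrom (suc i) u) (sPosFrom (suc i) v)

ahead⇒pointwise i []      nil    refl _ = []
ahead⇒pointwise i (_ ∷ _) nil    ()   _
ahead⇒pointwise i pending (LL a) len bound =
  ahead⇒pointwise (suc i) pending a len (All.map m≤n⇒m≤1+n bound)
ahead⇒pointwise i (p ∷ ps) (LS a) refl (p≤i ∷ bound) =
  p≤i ∷ ahead⇒pointwise (suc i) ps a refl (All.map m≤n⇒m≤1+n bound)
ahead⇒pointwise i [] (SS a) refl _ = ≤-refl ∷ ahead⇒pointwise (suc i) [] a refl []
ahead⇒pointwise i (p ∷ ps) (SS a) refl (p≤i ∷ bound) = p≤i ∷ enqueue i ps a bound
ahead⇒pointwise i ps       (SL a) refl bound         = enqueue i ps a bound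

enqueue {u} i ps a bound =
  subst (λ xs → Pointwise _≤_ xs _) (++-assoc ps (i ∷ []) (sPosFrom (suc i) u))
    (ahead⇒pointwise (suc i) (ps ++ i ∷ []) a
      (trans (length-++ ps) (+-comm (length ps) 1))
      (++⁺ (All.map m≤n⇒m≤1+n bound) (n≤1+n i ∷ [])))

ahead⇒≼ : ∀ {u v} → Ahead 0 0 u v → u ≼ v
ahead⇒≼ a = ahead⇒pointwise 1 [] a refl []

countL : List Letter → ℕ
countL []      = 0
countL (S ∷ w) = countL w
countL (L ∷ w) = suc (countL w)

Ss-pass-L : ∀ s u → Ahead 0 0 (replicate s S ++ L ∷ u) (L ∷ replicate s S ++ u)
Ss-pass-L zero    u = ahead-refl (L ∷ u)
Ss-pass-L (suc s) u = ahead-trans (SS (Ss-pass-L s u)) (SL (LS (ahead-refl _)))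

sorted-least : ∀ v → Ahead 0 0 (replicate (countS v) S ++ replicate (countL v) L) v
sorted-least []      = nil
sorted-least (S ∷ v) = SS (sorted-least v)
sorted-least (L ∷ v) =
  ahead-trans (Ss-pass-L (countS v) (replicate (countL v) L)) (LL (sorted-least v))

countS-swapLS : ∀ w → countS (swapLS w) ≡ countS w
countS-swapLS []          = refl
countS-swapLS (S ∷ w)     = cong suc (countS-swapLS w)
countS-swapLS (L ∷ [])    = refl
countS-swapLS (L ∷ S ∷ w) = cong suc (countS-swapLS w)
countS-swapLS (L ∷ L ∷ w) = countS-swapLS (L ∷ w)

countL-swapLS : ∀ w → countL (swapLS w) ≡ countL w
countL-swapLS []          = refl
countL-swapLS (S ∷ w)     = countL-swapLS w
countL-swapLS (L ∷ [])    = refl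
countL-swapLS (L ∷ S ∷ w) = cong suc (countL-swapLS w)
countL-swapLS (L ∷ L ∷ w) = cong suc (countL-swapLS (L ∷ w))

-- The possible shadows of a fall: nonempty words L^a S^b, since a fall is
-- decreasing and so lists its large entries before its small ones.
data FallShape : List Letter → Set where
  smalls     : ∀ b → FallShape (replicate (suc b) S)
  large      : ∀ {u} → FallShape u → FallShape (L ∷ u)
  lone-large : FallShape (L ∷ [])

replicate-∷ʳ : ∀ n (c : Letter) → replicate n c ++ [ c ] ≡ c ∷ replicate n c
replicate-∷ʳ zero    c = refl
replicate-∷ʳ (suc n) c = cong (c ∷_) (replicate-∷ʳ n c)

reverse-replicate : ∀ n (c : Letter) → reverse (replicate n c) ≡ replicate n c
reverse-replicate zero    c = refl
reverse-replicate (suc n) c = begin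
  reverse (c ∷ replicate n c)     ≡⟨ unfold-reverse c (replicate n c) ⟩
  reverse (replicate n c) ++ [ c ] ≡⟨ cong (_++ [ c ]) (reverse-replicate n c) ⟩
  replicate n c ++ [ c ]           ≡⟨ replicate-∷ʳ n c ⟩
  c ∷ replicate n c                ∎
  where open ≡-Reasoning

reverse-shape : ∀ {u} → FallShape u → reverse u ≡ replicate (countS u) S ++ replicate (countL u) L
reverse-shape (smalls b) = trans (reverse-replicate (suc b) S) (Ss-sorted (suc b))
  where
  Ss-sorted : ∀ n → replicate n S ≡ replicate (countS (replicate n S)) S ++ replicate (countL (replicate n S)) L
  Ss-sorted zero    = refl
  Ss-sorted (suc n) = cong (S ∷_) (Ss-sorted n)
reverse-shape (large {u} s) = begin
  reverse (L ∷ u)                                              ≡⟨ unfold-reverse L u ⟩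
  reverse u ++ [ L ]                                           ≡⟨ cong (_++ [ L ]) (reverse-shape s) ⟩
  (replicate (countS u) S ++ replicate (countL u) L) ++ [ L ] ≡⟨ ++-assoc (replicate (countS u) S) _ _ ⟩
  replicate (countS u) S ++ replicate (countL u) L ++ [ L ]   ≡⟨ cong (replicate (countS u) S ++_) (replicate-∷ʳ (countL u) L) ⟩
  replicate (countS u) S ++ replicate (suc (countL u)) L      ∎
  where open ≡-Reasoning
reverse-shape lone-large = refl

shape-flip : ∀ {u} → FallShape u → Ahead 0 0 (reverse u) (swapLS u)
shape-flip {u} s = subst (λ x → Ahead 0 0 x (swapLS u)) (sym sorted-reverse) (sorted-least (swapLS u))
  where
  sorted-reverse : reverse u ≡ replicate (countS (swapLS u)) S ++ replicate (countL (swapLS u)) L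
  sorted-reverse = trans (reverse-shape s)
    (sym (cong₂ (λ a b → replicate a S ++ replicate b L) (countS-swapLS u) (countL-swapLS u)))

-- A seam between a word B and the word that follows it is harmless for swapLS
-- when it is not an occurrence of LS: B ends in S, or the rest starts with L or is empty.
data Seam : List Letter → List Letter → Set where
  ends-S   : ∀ B rest → Seam (B ++ [ S ]) rest
  starts-L : ∀ B rest → Seam B (L ∷ rest)
  at-end   : ∀ B → Seam B []

swapLS-++-S : ∀ u v → swapLS (u ++ S ∷ v) ≡ swapLS (u ++ [ S ]) ++ swapLS v
swapLS-++-S []          v = refl
swapLS-++-S (S ∷ u)     v = cong (S ∷_) (swapLS-++-S u v)
swapLS-++-S (L ∷ [])    v = refl
swapLS-++-S (L ∷ S ∷ u) v = cong (λ x → S ∷ L ∷ x) (swapLS-++-S u v)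
swapLS-++-S (L ∷ L ∷ u) v = cong (L ∷_) (swapLS-++-S (L ∷ u) v)

swapLS-++-L : ∀ u v → swapLS (u ++ L ∷ v) ≡ swapLS u ++ swapLS (L ∷ v)
swapLS-++-L []          v = refl
swapLS-++-L (S ∷ u)     v = cong (S ∷_) (swapLS-++-L u v)
swapLS-++-L (L ∷ [])    v = refl
swapLS-++-L (L ∷ S ∷ u) v = cong (λ x → S ∷ L ∷ x) (swapLS-++-L u v)
swapLS-++-L (L ∷ L ∷ u) v = cong (L ∷_) (swapLS-++-L (L ∷ u) v)

swapLS-seam : ∀ {B rest} → Seam B rest → swapLS (B ++ rest) ≡ swapLS B ++ swapLS rest
swapLS-seam (ends-S B rest)   = trans (cong swapLS (++-assoc B [ S ] rest)) (swapLS-++-S B rest)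
swapLS-seam (starts-L B rest) = swapLS-++-L B rest
swapLS-seam (at-end B)        = trans (cong swapLS (++-identityʳ B)) (sym (++-identityʳ (swapLS B)))

seam-cons : ∀ {c B rest} → Seam B rest → Seam (c ∷ B) rest
seam-cons {c} (ends-S B rest)   = ends-S (c ∷ B) rest
seam-cons {c} (starts-L B rest) = starts-L (c ∷ B) rest
seam-cons {c} (at-end B)        = at-end (c ∷ B)

data Blocks : List (List Letter) → Set where
  []   : Blocks []
  cons : ∀ {B bs} → FallShape B → Seam B (concat bs) → Blocks bs → Blocks (B ∷ bs)

blocks-flip : ∀ {bs} → Blocks bs → Ahead 0 0 (concat (map reverse bs)) (swapLS (concat bs))
blocks-flip [] = nil
blocks-flip (cons shape seam rest) =
  subst (Ahead 0 0 _) (sym (swapLS-seam seam)) (ahead-++ (shape-flip shape) (blocks-flip rest))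

letter : ℕ → ℕ → Letter
letter k x = if x ≤ᵇ k then S else L

≤⇒letter-S : ∀ {k x} → x ≤ k → letter k x ≡ S
≤⇒letter-S {k} {x} x≤k with x ≤ᵇ k | ≤⇒≤ᵇ x≤k
... | true | _ = refl

letter-S⇒≤ : ∀ {k} x → letter k x ≡ S → x ≤ k
letter-S⇒≤ {k} x eq with x ≤ᵇ k in x≤ᵇk
... | true = ≤ᵇ⇒≤ x k (subst IsTrue (sym x≤ᵇk) _)

small-downward : ∀ k {x y} → y ≤ x → letter k x ≡ S → letter k y ≡ S
small-downward k {x} y≤x eq = ≤⇒letter-S (≤-trans y≤x (letter-S⇒≤ x eq))

large-upward : ∀ k {x y} → x ≤ y → letter k x ≡ L → letter k y ≡ L
large-upward k {x} {y} x≤y eq with y ≤ᵇ k in y≤ᵇk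
... | false = refl
... | true  with () ← trans (sym eq) (≤⇒letter-S (≤-trans x≤y (≤ᵇ⇒≤ y k (subst IsTrue (sym y≤ᵇk) _))))

singleton-shape : ∀ c → FallShape [ c ]
singleton-shape S = smalls 0
singleton-shape L = lone-large

extend-shape : ∀ {c d u} → FallShape (d ∷ u) → (c ≡ S → d ≡ S) → FallShape (c ∷ d ∷ u)
extend-shape {L} shape _     = large shape
extend-shape {S} shape small with refl ← small refl = prepend-S shape
  where
  prepend-S : ∀ {u} → FallShape (S ∷ u) → FallShape (S ∷ S ∷ u)
  prepend-S (smalls b) = smalls (suc b)

singleton-seam : ∀ {c d u} → (c ≡ L → d ≡ L) → Seam [ c ] (d ∷ u)
singleton-seam {S} {d} {u} _     = ends-S [] (d ∷ u)
singleton-seam {L} {d} {u} stays-large with refl ← stays-large refl = starts-L [ L ] u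

falls-blocks : ∀ k σ → Blocks (map (map (letter k)) (falls σ))
falls-blocks k [] = []
falls-blocks k (x ∷ xs) with falls xs | falls-blocks k xs
... | []           | _                 = cons (singleton-shape _) (at-end _) []
... | [] ∷ _       | cons () _ _
... | (y ∷ r) ∷ rs | cons shape seam bs with y <ᵇ x in y<ᵇx
...   | true  = cons (extend-shape shape (small-downward k (<⇒≤ y<x))) (seam-cons seam) bs
  where
  y<x : y < x
  y<x = <ᵇ⇒< y x (subst IsTrue (sym y<ᵇx) _)
...   | false = cons (singleton-shape _) (singleton-seam (large-upward k x≤y)) (cons shape seam bs)
  where
  x≤y : x ≤ y
  x≤y = ≮⇒≥ (λ y<x → subst IsTrue y<ᵇx (<⇒<ᵇ y<x))

concat-falls : ∀ σ → concat (falls σ) ≡ σ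
concat-falls [] = refl
concat-falls (x ∷ xs) with falls xs | concat-falls xs
... | []           | ih = cong (x ∷_) ih
... | [] ∷ _       | ih = cong (x ∷_) ih
... | (y ∷ r) ∷ rs | ih with y <ᵇ x
...   | true  = cong (x ∷_) ih
...   | false = cong (x ∷_) ih

shadow-flip : ∀ k σ → shadow k (T σ) ≼ swapLS (shadow k σ)
shadow-flip k σ = ahead⇒≼ (subst₂ (Ahead 0 0) flipped swapped (blocks-flip (falls-blocks k σ)))
  where
  open ≡-Reasoning
  fs : List (List ℕ)
  fs = falls σ
  swapped : swapLS (concat (map (map (letter k)) fs)) ≡ swapLS (shadow k σ)
  swapped = cong swapLS (trans (concat-map fs) (cong (map (letter k)) (concat-falls σ)))
  flipped : concat (map reverse (map (map (letter k)) fs)) ≡ shadow k (T σ)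
  flipped = begin
    concat (map reverse (map (map (letter k)) fs)) ≡⟨ cong concat (sym (map-∘ fs)) ⟩
    concat (map (reverse ∘ map (letter k)) fs)     ≡⟨ cong concat (map-cong (λ B → sym (reverse-map (letter k) B)) fs) ⟩
    concat (map (map (letter k) ∘ reverse) fs)     ≡⟨ cong concat (map-∘ fs) ⟩
    concat (map (map (letter k)) (map reverse fs)) ≡⟨ concat-map (map reverse fs) ⟩
    shadow k (T σ)                                 ∎

-- swapLS on S-positions: an S at position q, the previous S being at position p
-- (or p = the start offset), moves to q - 1 unless q = p + 1 (then it stays put).
shift : ℕ → ℕ → ℕ
shift p q with q ≟ suc p
... | yes _ = q
... | no  _ = pred q

shiftAll : ℕ → List ℕ → List ℕ
shiftAll p []      = []
shiftAll p (q ∷ qs) = shift p q ∷ shiftAll q qs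

shift-adjacent : ∀ p → shift p (suc p) ≡ suc p
shift-adjacent p with suc p ≟ suc p
... | yes _   = refl
... | no  p≢p = contradiction refl p≢p

shift-far : ∀ p q → suc p < q → shift p q ≡ pred q
shift-far p q p+1<q with q ≟ suc p
... | yes refl = contradiction p+1<q (<-irrefl refl)
... | no  _    = refl

shiftAll-far : ∀ p p′ j w → suc p < j → suc p′ < j →
  shiftAll p (sPosFrom j w) ≡ shiftAll p′ (sPosFrom j w)
shiftAll-far p p′ j []      _   _    = refl
shiftAll-far p p′ j (S ∷ w) p<j p′<j = cong (_∷ _) (trans (shift-far p j p<j) (sym (shift-far p′ j p′<j)))
shiftAll-far p p′ j (L ∷ w) p<j p′<j = shiftAll-far p p′ (suc j) w (m<n⇒m<1+n p<j) (m<n⇒m<1+n p′<j)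

sPositions-swapLS : ∀ p w → sPosFrom (suc p) (swapLS w) ≡ shiftAll p (sPosFrom (suc p) w)
sPositions-swapLS p []          = refl
sPositions-swapLS p (S ∷ w)     = cong₂ _∷_ (sym (shift-adjacent p)) (sPositions-swapLS (suc p) w)
sPositions-swapLS p (L ∷ [])    = refl
sPositions-swapLS p (L ∷ S ∷ w) = cong₂ _∷_ (sym (shift-far p (suc (suc p)) ≤-refl)) (sPositions-swapLS (suc (suc p)) w)
sPositions-swapLS p (L ∷ L ∷ w) =
  trans (sPositions-swapLS (suc p) (L ∷ w)) (shiftAll-far (suc p) p (3 + p) w ≤-refl (m<n⇒m<1+n (n<1+n (suc p))))

Ascending : ℕ → List ℕ → Set
Ascending p []       = ⊤
Ascending p (q ∷ qs) = p < q × Ascending q qs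

sPositions-ascending : ∀ p j w → p < j → Ascending p (sPosFrom j w)
sPositions-ascending p j []      _   = tt
sPositions-ascending p j (S ∷ w) p<j = p<j , sPositions-ascending j (suc j) w (n<1+n j)
sPositions-ascending p j (L ∷ w) p<j = sPositions-ascending p (suc j) w (m<n⇒m<1+n p<j)

shift-mono : ∀ {p p′ q q′} → p ≤ p′ → p < q → p′ < q′ → q ≤ q′ → shift p q ≤ shift p′ q′
shift-mono {p} {p′} {q} {q′} p≤p′ p<q p′<q′ q≤q′ with q ≟ suc p | q′ ≟ suc p′
... | yes _    | yes _   = q≤q′
... | yes refl | no q′≢  = ≤-trans (s≤s p≤p′) (pred-mono-≤ (≤∧≢⇒< p′<q′ (q′≢ ∘ sym)))
... | no _     | yes _   = ≤-trans pred[n]≤n q≤q′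
... | no _     | no _    = pred-mono-≤ q≤q′

shiftAll-mono : ∀ {p p′ qs qs′} → p ≤ p′ → Ascending p qs → Ascending p′ qs′ →
  Pointwise _≤_ qs qs′ → Pointwise _≤_ (shiftAll p qs) (shiftAll p′ qs′)
shiftAll-mono p≤p′ _ _ [] = []
shiftAll-mono p≤p′ (p<q , asc) (p′<q′ , asc′) (q≤q′ ∷ qs≤qs′) =
  shift-mono p≤p′ p<q p′<q′ q≤q′ ∷ shiftAll-mono q≤q′ asc asc′ qs≤qs′

swapLS-mono : ∀ u w → u ≼ w → swapLS u ≼ swapLS w
swapLS-mono u w u≼w rewrite sPositions-swapLS 0 u | sPositions-swapLS 0 w =
  shiftAll-mono z≤n (sPositions-ascending 0 1 u (n<1+n 0)) (sPositions-ascending 0 1 w (n<1+n 0)) u≼w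

proposition22 : (n k : ℕ) (σ : List ℕ) (w : List Letter) →
    IsPerm n σ → 1 ≤ k → k ≤ n ∸ 1 → InX k n w → w ≢ minWord k n →
    shadow k σ ≼ w → shadow k (T σ) ≼ swapLS w
proposition22 n k σ w _ _ _ _ _ shadow≼w =
  transitive ≤-trans (shadow-flip k σ) (swapLS-mono (shadow k σ) w shadow≼w)
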